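{- For every integer $n\geq 0$, \[ B_n \setminus\{0\} = \coprod_{j=0}^{n} (1+i)^j D_{n-j}, \] where the union is disjoint and $(1+i)^j D = \{(1+i)^j d : d\in D\}$.
   Context: For $n \geq 0$, $B_n = \left\{ \sum_{j=0}^n v_j (1+i)^j : v_j \in \{0,\pm 1,\pm i\}\right\} \subset \mathbb{Z}[i]$. For $n\geq 0$ define $w_n = 2^{k+1}+2^k$ if $n=2k$ and $w_n = 2^{k+2}$ if $n=2k+1$. For $n\geq 0$ define \[ D_n = \{ x+yi \in \mathbb{Z}[i] : 2 \nmid (x+y);\ |x|,|y| \leq w_n - 2;\ |x|+|y| \leq w_{n+1}-3 \}. \] -}

module Defs where

open import Data.Nat as ℕ using (ℕ; zero; suc; _∸_; _%_; _/_; _≡ᵇ_)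
open import Data.Integer as ℤ using (ℤ; +_; -_; _+_; _-_; _*_; ∣_∣; _≤_)
open import Data.Integer.Divisibility using (_∣_)
open import Data.Fin using (Fin; inject₁; fromℕ)
open import Data.Bool using (if_then_else_)
open import Data.Product using (Σ; _×_)
open import Relation.Nullary using (¬_)
open import Relation.Binary.PropositionalEquality using (_≡_)

record ℤ[i] : Set where
  constructor _+_i
  field
    re : ℤ
    im : ℤ
open ℤ[i] public

0ᵍ : ℤ[i]
0ᵍ = (+ 0) + (+ 0) i

_+ᵍ_ : ℤ[i] → ℤ[i] → ℤ[i]
(a + b i) +ᵍ (c + d i) = (a + c) + (b + d) i

_*ᵍ_ : ℤ[i] → ℤ[i] → ℤ[i]
(a + b i) *ᵍ (c + d i) = (a * c - b * d) + (a * d + b * c) i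

1+i : ℤ[i]
1+i = (+ 1) + (+ 1) i

pow1+i : ℕ → ℤ[i]
pow1+i zero    = (+ 1) + (+ 0) i
pow1+i (suc j) = 1+i *ᵍ pow1+i j

data Digit : Set where
  d0 d1 d-1 di d-i : Digit

digitVal : Digit → ℤ[i]
digitVal d0  = (+ 0) + (+ 0) i
digitVal d1  = (+ 1) + (+ 0) i
digitVal d-1 = (- (+ 1)) + (+ 0) i
digitVal di  = (+ 0) + (+ 1) i
digitVal d-i = (+ 0) + (- (+ 1)) i

digitSum : (m : ℕ) → (Fin m → Digit) → ℤ[i]
digitSum zero    v = 0ᵍ
digitSum (suc m) v = digitSum m (λ k → v (inject₁ k)) +ᵍ (digitVal (v (fromℕ m)) *ᵍ pow1+i m)

InB : ℕ → ℤ[i] → Set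
InB n z = Σ (Fin (suc n) → Digit) (λ v → digitSum (suc n) v ≡ z)

wℕ : ℕ → ℕ
wℕ n = if (n % 2) ≡ᵇ 0
         then 2 ℕ.^ (k ℕ.+ 1) ℕ.+ 2 ℕ.^ k
         else 2 ℕ.^ (k ℕ.+ 2)
  where k = n / 2

w : ℕ → ℤ
w n = + wℕ n

InD : ℕ → ℤ[i] → Set
InD n (x + y i) =
  (¬ ((+ 2) ∣ (x + y))) ×
  ((+ ∣ x ∣) ≤ w n - + 2) ×
  ((+ ∣ y ∣) ≤ w n - + 2) ×
  ((+ ∣ x ∣) + (+ ∣ y ∣) ≤ w (suc n) - + 3)

module Submission where

open import Defs
open import Data.Nat as ℕ using (ℕ; zero; suc; z≤n; s≤s; _∸_)
import Data.Nat.Properties as ℕ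
import Data.Nat.Divisibility as ℕ
open import Data.Nat.DivMod using ([m+n]%n≡m%n; m/n≡1+[m∸n]/n)
import Data.Nat.Tactic.RingSolver as ℕ-Solver
open import Data.Integer using (ℤ; +_; -[1+_]; -_; _+_; _-_; _*_; _%_; _/_; ∣_∣; _≤_; +≤+; -≤+; -≤-)
open import Data.Integer.Properties
  using (+-identityˡ; +-comm; +-mono-≤; ≤-refl; ≤-trans; _≤?_; i≤j⇒0≤j-i; 0≤i-j⇒j≤i; i≤i+j;
         pos-*; *-distribʳ-+; *-cancelʳ-≡; *-cancelʳ-≤-pos)
open import Data.Integer.DivMod using (a≡a%n+[a/n]*n; n%d<d)
open import Data.Integer.Divisibility using (_∣_)
import Data.Integer.Divisibility.Signed as Signed
open import Data.Integer.Tactic.RingSolver using (solve; solve-∀)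
open import Data.Bool using (Bool; true; false; if_then_else_)
open import Data.Fin using (inject₁; fromℕ) renaming (zero to fzero)
open import Data.Vec.Functional using (tail) renaming (_∷_ to _◂_)
open import Data.List using (_∷_; [])
open import Data.Product using (Σ; ∃; _×_; _,_)
open import Data.Sum using (_⊎_; inj₁; inj₂; [_,_]′)
open import Data.Empty using (⊥-elim)
open import Function using (_∘_)
open import Function.Bundles using (_⇔_; mk⇔)
open import Relation.Nullary using (¬_; contradiction)
open import Relation.Nullary.Decidable using (True; toWitness)
open import Relation.Binary.PropositionalEquality

-- Writing z ∈ B_n as v₀ + (1+i) b with b ∈ B_{n-1}, induction shows that B_n lies in the
-- octagon |x|, |y| ≤ w_n − 2, |x| + |y| ≤ w_{n+1} − 3 (the bounds propagate because
-- w_{n+2} = 2 w_n).  A nonzero z ∈ B_n is (1+i)^j times an element of B_{n-j} whose lowest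
-- digit is a unit, and such an element has x + y odd, so it lies in D_{n-j}.  Conversely
-- D_n ⊆ B_n: from z ∈ D_{n+1} subtract the unit u that makes both coordinates odd, chosen
-- to point the same way as the even coordinate; then z − u = (1+i) e, and e ∈ D_n because
-- w_{n+1} is even and w_{n+1} + 2 ≤ w_{n+2}.  The union is disjoint because x + y is odd on every
-- D_m but even on (1+i) ℤ[i], so j is the (1+i)-adic valuation of z.

infixl 6 _⊕_
_⊕_ : ∀ {a b c d} → a ≤ b → c ≤ d → a + c ≤ b + d
_⊕_ = +-mono-≤

≤-from : ∀ {p q i j} → p ≤ q → q - p ≡ j - i → i ≤ j
≤-from p≤q eq = 0≤i-j⇒j≤i (subst (+ 0 ≤_) eq (i≤j⇒0≤j-i p≤q))

≤-from-double : ∀ {p q i j} → p ≤ q → q - p ≡ (j - i) * + 2 → i ≤ j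
≤-from-double {i = i} {j} p≤q eq =
  0≤i-j⇒j≤i (*-cancelʳ-≤-pos (+ 0) (j - i) (+ 2) (subst (+ 0 ≤_) eq (i≤j⇒0≤j-i p≤q)))

≤-by-decision : ∀ {i j} {i≤?j : True (i ≤? j)} → i ≤ j
≤-by-decision {i≤?j = i≤?j} = toWitness i≤?j

0≤⊎≤-1 : ∀ t → + 0 ≤ t ⊎ t ≤ - + 1
0≤⊎≤-1 (+ n)    = inj₁ (+≤+ z≤n)
0≤⊎≤-1 -[1+ n ] = inj₂ (-≤- z≤n)

0≤2t+1⇒0≤2t : ∀ t → + 0 ≤ t * + 2 + + 1 → + 0 ≤ t * + 2
0≤2t+1⇒0≤2t (+ n)    _ = subst (+ 0 ≤_) (pos-* n 2) (+≤+ z≤n)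
0≤2t+1⇒0≤2t -[1+ n ] ()

-- Parity in ℤ

Even : ℤ → Set
Even t = ∃ λ c → t ≡ c * + 2

Odd : ℤ → Set
Odd t = ∃ λ k → t ≡ k * + 2 + + 1

parity : ∀ t → Even t ⊎ Odd t
parity t with t % + 2 | a≡a%n+[a/n]*n t (+ 2) | n%d<d t (+ 2)
... | 0           | t≡ | _ = inj₁ (t / + 2 , trans t≡ (+-identityˡ _))
... | 1           | t≡ | _ = inj₂ (t / + 2 , trans t≡ (+-comm (+ 1) ((t / + 2) * + 2)))
... | suc (suc _) | _  | s≤s (s≤s ())

even⇒2∣ : ∀ {t} → Even t → + 2 ∣ t
even⇒2∣ (c , t≡) = Signed.∣⇒∣ᵤ (Signed.divides c t≡)

odd⇒2∤ : ∀ {t} → Odd t → ¬ (+ 2 ∣ t)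
odd⇒2∤ (k , refl) 2∣2k+1 = contradiction (ℕ.∣1⇒≡1 (Signed.∣⇒∣ᵤ 2∣1)) (λ ())
  where
  2∣1 : + 2 Signed.∣ + 1
  2∣1 = Signed.∣m+n∣m⇒∣n (Signed.∣ᵤ⇒∣ 2∣2k+1) (Signed.∣n⇒∣m*n k (Signed.∣-refl {+ 2}))

2∤⇒odd : ∀ {t} → ¬ (+ 2 ∣ t) → Odd t
2∤⇒odd {t} 2∤t with parity t
... | inj₁ even = ⊥-elim (2∤t (even⇒2∣ even))
... | inj₂ odd  = odd

odd-neg : ∀ {t} → Odd t → Odd (- t)
odd-neg (k , refl) = - k - + 1 , solve (k ∷ [])

even⇒¬odd : ∀ {t} → Even t → ¬ Odd t
even⇒¬odd even odd = odd⇒2∤ odd (even⇒2∣ even)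

odd≤2h-2⇒odd≤2h-3 : ∀ {t} h → Odd t → t ≤ h * + 2 - + 2 → t ≤ h * + 2 - + 3
odd≤2h-2⇒odd≤2h-3 h (k , refl) t≤ =
  ≤-from (0≤2t+1⇒0≤2t (h - k - + 2) (≤-from t≤ (solve (h ∷ k ∷ [])))) (solve (h ∷ k ∷ []))

∣i∣≡i⊎∣i∣≡-i : ∀ i → + ∣ i ∣ ≡ i ⊎ + ∣ i ∣ ≡ - i
∣i∣≡i⊎∣i∣≡-i (+ n)    = inj₁ refl
∣i∣≡i⊎∣i∣≡-i -[1+ n ] = inj₂ refl

i≤∣i∣ : ∀ i → i ≤ + ∣ i ∣
i≤∣i∣ (+ n)    = ≤-refl
i≤∣i∣ -[1+ n ] = -≤+

-i≤∣i∣ : ∀ i → - i ≤ + ∣ i ∣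
-i≤∣i∣ (+ zero)  = ≤-refl
-i≤∣i∣ (+ suc n) = -≤+
-i≤∣i∣ -[1+ n ]  = ≤-refl

-- The bounds |x|, |y| ≤ M and |x| + |y| ≤ S, unfolded into linear inequalities.
record Octagon (M S x y : ℤ) : Set where
  constructor octagon
  field
    x≤M     : x ≤ M
    -x≤M    : - x ≤ M
    y≤M     : y ≤ M
    -y≤M    : - y ≤ M
    x+y≤S   : x + y ≤ S
    x-y≤S   : x + - y ≤ S
    -x+y≤S  : - x + y ≤ S
    -x-y≤S  : - x + - y ≤ S

octagon-mono : ∀ {M S M′ S′ x y} → M ≤ M′ → S ≤ S′ → Octagon M S x y → Octagon M′ S′ x y
octagon-mono M≤ S≤ (octagon h₁ h₂ h₃ h₄ h₅ h₆ h₇ h₈) =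
  octagon (≤-trans h₁ M≤) (≤-trans h₂ M≤) (≤-trans h₃ M≤) (≤-trans h₄ M≤)
          (≤-trans h₅ S≤) (≤-trans h₆ S≤) (≤-trans h₇ S≤) (≤-trans h₈ S≤)

±i≤j⇒∣i∣≤j : ∀ {i j} → i ≤ j → - i ≤ j → + ∣ i ∣ ≤ j
±i≤j⇒∣i∣≤j {i} {j} i≤j -i≤j with ∣i∣≡i⊎∣i∣≡-i i
... | inj₁ ∣i∣≡i  = subst (_≤ j) (sym ∣i∣≡i) i≤j
... | inj₂ ∣i∣≡-i = subst (_≤ j) (sym ∣i∣≡-i) -i≤j

±i±k≤j⇒∣i∣+∣k∣≤j : ∀ {i k j} → i + k ≤ j → i + - k ≤ j → - i + k ≤ j → - i + - k ≤ j →
                    + ∣ i ∣ + + ∣ k ∣ ≤ j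
±i±k≤j⇒∣i∣+∣k∣≤j {i} {k} {j} h₁ h₂ h₃ h₄ with ∣i∣≡i⊎∣i∣≡-i i | ∣i∣≡i⊎∣i∣≡-i k
... | inj₁ ∣i∣≡ | inj₁ ∣k∣≡ = subst (_≤ j) (sym (cong₂ _+_ ∣i∣≡ ∣k∣≡)) h₁
... | inj₁ ∣i∣≡ | inj₂ ∣k∣≡ = subst (_≤ j) (sym (cong₂ _+_ ∣i∣≡ ∣k∣≡)) h₂
... | inj₂ ∣i∣≡ | inj₁ ∣k∣≡ = subst (_≤ j) (sym (cong₂ _+_ ∣i∣≡ ∣k∣≡)) h₃
... | inj₂ ∣i∣≡ | inj₂ ∣k∣≡ = subst (_≤ j) (sym (cong₂ _+_ ∣i∣≡ ∣k∣≡)) h₄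

OddSum : ℤ[i] → Set
OddSum z = Odd (re z + im z)

InOctagon : ℕ → ℤ[i] → Set
InOctagon n z = Octagon (w n - + 2) (w (suc n) - + 3) (re z) (im z)

InD⇒OddSum : ∀ n z → InD n z → OddSum z
InD⇒OddSum n z (2∤x+y , _) = 2∤⇒odd 2∤x+y

InD⇒InOctagon : ∀ n z → InD n z → InOctagon n z
InD⇒InOctagon n (x + y i) (_ , ∣x∣≤ , ∣y∣≤ , ∣x∣+∣y∣≤) = octagon
  (≤-trans (i≤∣i∣ x) ∣x∣≤) (≤-trans (-i≤∣i∣ x) ∣x∣≤)
  (≤-trans (i≤∣i∣ y) ∣y∣≤) (≤-trans (-i≤∣i∣ y) ∣y∣≤)
  (≤-trans (i≤∣i∣ x ⊕ i≤∣i∣ y) ∣x∣+∣y∣≤)  (≤-trans (i≤∣i∣ x ⊕ -i≤∣i∣ y) ∣x∣+∣y∣≤)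
  (≤-trans (-i≤∣i∣ x ⊕ i≤∣i∣ y) ∣x∣+∣y∣≤) (≤-trans (-i≤∣i∣ x ⊕ -i≤∣i∣ y) ∣x∣+∣y∣≤)

OddSum∧InOctagon⇒InD : ∀ n z → OddSum z → InOctagon n z → InD n z
OddSum∧InOctagon⇒InD n (x + y i) odd (octagon h₁ h₂ h₃ h₄ h₅ h₆ h₇ h₈) =
  odd⇒2∤ odd , ±i≤j⇒∣i∣≤j {x} h₁ h₂ , ±i≤j⇒∣i∣≤j {y} h₃ h₄ ,
  ±i±k≤j⇒∣i∣+∣k∣≤j {x} {y} h₅ h₆ h₇ h₈

-- The sequence w

wℕ-suc-suc : ∀ n → wℕ (suc (suc n)) ≡ wℕ n ℕ.+ wℕ n
wℕ-suc-suc n =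
  trans (cong₂ formula (cong (ℕ._≡ᵇ 0) (%-step n)) (/-step n)) (formula-suc (n ℕ.% 2 ℕ.≡ᵇ 0) (n ℕ./ 2))
  where
  -- wℕ n unfolds to formula (n % 2 ≡ᵇ 0) (n / 2)
  formula : Bool → ℕ → ℕ
  formula b k = if b then 2 ℕ.^ (k ℕ.+ 1) ℕ.+ 2 ℕ.^ k else 2 ℕ.^ (k ℕ.+ 2)
  double : ∀ a → 2 ℕ.* a ≡ a ℕ.+ a
  double = ℕ-Solver.solve-∀
  double-sum : ∀ a b → 2 ℕ.* a ℕ.+ 2 ℕ.* b ≡ (a ℕ.+ b) ℕ.+ (a ℕ.+ b)
  double-sum = ℕ-Solver.solve-∀
  formula-suc : ∀ b k → formula b (suc k) ≡ formula b k ℕ.+ formula b k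
  formula-suc true  k = double-sum (2 ℕ.^ (k ℕ.+ 1)) (2 ℕ.^ k)
  formula-suc false k = double (2 ℕ.^ (k ℕ.+ 2))
  %-step : ∀ n → suc (suc n) ℕ.% 2 ≡ n ℕ.% 2
  %-step n = trans (cong (ℕ._% 2) (ℕ.+-comm 2 n)) ([m+n]%n≡m%n n 2)
  /-step : ∀ n → suc (suc n) ℕ./ 2 ≡ suc (n ℕ./ 2)
  /-step n = m/n≡1+[m∸n]/n {suc (suc n)} {2} (s≤s (s≤s z≤n))

w-suc-suc : ∀ n → w (suc (suc n)) ≡ w n + w n
w-suc-suc n = cong +_ (wℕ-suc-suc n)

w-suc-even : ∀ m → ∃ λ h → w (suc m) ≡ h * + 2
w-suc-even zero          = + 2 , refl
w-suc-even (suc zero)    = + 3 , refl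
w-suc-even (suc (suc m)) with w-suc-even m
... | h , w≡2h = h + h , (begin
  w (suc (suc (suc m)))  ≡⟨ w-suc-suc (suc m) ⟩
  w (suc m) + w (suc m)  ≡⟨ cong₂ _+_ w≡2h w≡2h ⟩
  h * + 2 + h * + 2      ≡⟨ *-distribʳ-+ (+ 2) h h ⟨
  (h + h) * + 2          ∎)
  where open ≡-Reasoning

+2≤⇒double+2≤double : ∀ {a b} → a + + 2 ≤ b → (a + a) + + 2 ≤ b + b
+2≤⇒double+2≤double {a} {b} a+2≤b =
  ≤-from (a+2≤b ⊕ a+2≤b ⊕ ≤-by-decision {+ 0} {+ 2}) (solve (a ∷ b ∷ []))

w-suc+2≤w-suc-suc : ∀ m → w (suc m) + + 2 ≤ w (suc (suc m))
w-suc+2≤w-suc-suc zero          = ≤-refl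
w-suc+2≤w-suc-suc (suc zero)    = ≤-refl
w-suc+2≤w-suc-suc (suc (suc m)) =
  subst₂ (λ a b → a + + 2 ≤ b) (sym (w-suc-suc (suc m))) (sym (w-suc-suc (suc (suc m))))
         (+2≤⇒double+2≤double {w (suc m)} (w-suc+2≤w-suc-suc m))

4≤w-suc : ∀ m → + 4 ≤ w (suc m)
4≤w-suc zero          = ≤-refl
4≤w-suc (suc zero)    = ≤-by-decision
4≤w-suc (suc (suc m)) =
  ≤-trans (4≤w-suc m) (subst (w (suc m) ≤_) (sym (w-suc-suc (suc m))) (i≤i+j (w (suc m)) (w (suc m))))

-- Arithmetic in ℤ[i]

*ᵍ-assoc : ∀ p q r → p *ᵍ (q *ᵍ r) ≡ (p *ᵍ q) *ᵍ r
*ᵍ-assoc (a + b i) (c + d i) (e + f i) = cong₂ _+_i (re-assoc a b c d e f) (im-assoc a b c d e f)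
  where
  re-assoc : ∀ a b c d e f →
    a * (c * e - d * f) - b * (c * f + d * e) ≡ (a * c - b * d) * e - (a * d + b * c) * f
  re-assoc = solve-∀
  im-assoc : ∀ a b c d e f →
    a * (c * f + d * e) + b * (c * e - d * f) ≡ (a * c - b * d) * f + (a * d + b * c) * e
  im-assoc = solve-∀

pow1+i-zero-*ᵍ : ∀ z → pow1+i 0 *ᵍ z ≡ z
pow1+i-zero-*ᵍ (x + y i) = cong₂ _+_i (re-one x y) (im-one x y)
  where
  re-one : ∀ x y → + 1 * x - + 0 * y ≡ x
  re-one = solve-∀
  im-one : ∀ x y → + 1 * y + + 0 * x ≡ y
  im-one = solve-∀

pow1+i-suc-*ᵍ : ∀ j z → pow1+i (suc j) *ᵍ z ≡ 1+i *ᵍ (pow1+i j *ᵍ z)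
pow1+i-suc-*ᵍ j z = sym (*ᵍ-assoc 1+i (pow1+i j) z)

+ᵍ-identityˡ : ∀ z → 0ᵍ +ᵍ z ≡ z
+ᵍ-identityˡ (x + y i) = cong₂ _+_i (+-identityˡ x) (+-identityˡ y)

1+i*ᵍ-re+im : ∀ z → re (1+i *ᵍ z) + im (1+i *ᵍ z) ≡ re z * + 2
1+i*ᵍ-re+im (x + y i) = re+im x y
  where
  re+im : ∀ x y → (+ 1 * x - + 1 * y) + (+ 1 * y + + 1 * x) ≡ x * + 2
  re+im = solve-∀

1+i*ᵍ-im-re : ∀ z → im (1+i *ᵍ z) - re (1+i *ᵍ z) ≡ im z * + 2
1+i*ᵍ-im-re (x + y i) = im-re x y
  where
  im-re : ∀ x y → (+ 1 * y + + 1 * x) - (+ 1 * x - + 1 * y) ≡ y * + 2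
  im-re = solve-∀

1+i*ᵍ-injective : ∀ a b → 1+i *ᵍ a ≡ 1+i *ᵍ b → a ≡ b
1+i*ᵍ-injective (a₁ + a₂ i) (b₁ + b₂ i) eq = cong₂ _+_i
  (*-cancelʳ-≡ a₁ b₁ (+ 2) (begin
    a₁ * + 2                                          ≡⟨ 1+i*ᵍ-re+im (a₁ + a₂ i) ⟨
    re (1+i *ᵍ (a₁ + a₂ i)) + im (1+i *ᵍ (a₁ + a₂ i)) ≡⟨ cong₂ _+_ (cong re eq) (cong im eq) ⟩
    re (1+i *ᵍ (b₁ + b₂ i)) + im (1+i *ᵍ (b₁ + b₂ i)) ≡⟨ 1+i*ᵍ-re+im (b₁ + b₂ i) ⟩
    b₁ * + 2                                          ∎))
  (*-cancelʳ-≡ a₂ b₂ (+ 2) (begin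
    a₂ * + 2                                          ≡⟨ 1+i*ᵍ-im-re (a₁ + a₂ i) ⟨
    im (1+i *ᵍ (a₁ + a₂ i)) - re (1+i *ᵍ (a₁ + a₂ i)) ≡⟨ cong₂ _-_ (cong im eq) (cong re eq) ⟩
    im (1+i *ᵍ (b₁ + b₂ i)) - re (1+i *ᵍ (b₁ + b₂ i)) ≡⟨ 1+i*ᵍ-im-re (b₁ + b₂ i) ⟩
    b₂ * + 2                                          ∎))
  where open ≡-Reasoning

*ᵍ-+ᵍ-regroup : ∀ a p s r q → (a +ᵍ (p *ᵍ s)) +ᵍ (r *ᵍ (p *ᵍ q)) ≡ a +ᵍ (p *ᵍ (s +ᵍ (r *ᵍ q)))
*ᵍ-+ᵍ-regroup (a₁ + a₂ i) (p₁ + p₂ i) (s₁ + s₂ i) (r₁ + r₂ i) (q₁ + q₂ i) =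
  cong₂ _+_i (re-regroup a₁ p₁ p₂ s₁ s₂ r₁ r₂ q₁ q₂) (im-regroup a₂ p₁ p₂ s₁ s₂ r₁ r₂ q₁ q₂)
  where
  re-regroup : ∀ a₁ p₁ p₂ s₁ s₂ r₁ r₂ q₁ q₂ →
    (a₁ + (p₁ * s₁ - p₂ * s₂)) + (r₁ * (p₁ * q₁ - p₂ * q₂) - r₂ * (p₁ * q₂ + p₂ * q₁))
    ≡ a₁ + (p₁ * (s₁ + (r₁ * q₁ - r₂ * q₂)) - p₂ * (s₂ + (r₁ * q₂ + r₂ * q₁)))
  re-regroup = solve-∀
  im-regroup : ∀ a₂ p₁ p₂ s₁ s₂ r₁ r₂ q₁ q₂ →
    (a₂ + (p₁ * s₂ + p₂ * s₁)) + (r₁ * (p₁ * q₂ + p₂ * q₁) + r₂ * (p₁ * q₁ - p₂ * q₂))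
    ≡ a₂ + (p₁ * (s₂ + (r₁ * q₂ + r₂ * q₁)) + p₂ * (s₁ + (r₁ * q₁ - r₂ * q₂)))
  im-regroup = solve-∀

-- B_n in Horner form

HornerB : ℕ → ℤ[i] → Set
HornerB zero    z = ∃ λ u → digitVal u ≡ z
HornerB (suc n) z = ∃ λ u → ∃ λ b → HornerB n b × digitVal u +ᵍ (1+i *ᵍ b) ≡ z

digitSum-one : ∀ v → digitSum 1 v ≡ digitVal (v fzero)
digitSum-one v with v fzero
... | d0  = refl
... | d1  = refl
... | d-1 = refl
... | di  = refl
... | d-i = refl

digitSum-horner : ∀ m v → digitSum (suc m) v ≡ digitVal (v fzero) +ᵍ (1+i *ᵍ digitSum m (tail v))
digitSum-horner zero v with v fzero
... | d0  = refl
... | d1  = refl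
... | d-1 = refl
... | di  = refl
... | d-i = refl
digitSum-horner (suc m) v = begin
  digitSum (suc m) (v ∘ inject₁) +ᵍ (top *ᵍ pow1+i (suc m))
    ≡⟨ cong (_+ᵍ (top *ᵍ pow1+i (suc m))) (digitSum-horner m (v ∘ inject₁)) ⟩
  (bottom +ᵍ (1+i *ᵍ digitSum m (tail v ∘ inject₁))) +ᵍ (top *ᵍ (1+i *ᵍ pow1+i m))
    ≡⟨ *ᵍ-+ᵍ-regroup bottom 1+i (digitSum m (tail v ∘ inject₁)) top (pow1+i m) ⟩
  bottom +ᵍ (1+i *ᵍ digitSum (suc m) (tail v)) ∎
  where
  open ≡-Reasoning
  bottom = digitVal (v fzero)
  top    = digitVal (v (fromℕ (suc m)))

InB⇒HornerB : ∀ n z → InB n z → HornerB n z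
InB⇒HornerB zero    z (v , v≡z) = v fzero , trans (sym (digitSum-one v)) v≡z
InB⇒HornerB (suc n) z (v , v≡z) =
  v fzero , digitSum (suc n) (tail v) , InB⇒HornerB n _ (tail v , refl) ,
  trans (sym (digitSum-horner (suc n) v)) v≡z

HornerB⇒InB : ∀ n z → HornerB n z → InB n z
HornerB⇒InB zero    z (u , u≡z) = (λ _ → u) , trans (digitSum-one (λ _ → u)) u≡z
HornerB⇒InB (suc n) z (u , b , b∈B , u+b≡z) with HornerB⇒InB n b b∈B
... | v , v≡b =
  u ◂ v , trans (digitSum-horner (suc n) (u ◂ v)) (trans (cong (λ b → digitVal u +ᵍ (1+i *ᵍ b)) v≡b) u+b≡z)

digit-octagon : ∀ u → Octagon (+ 1) (+ 1) (re (digitVal u)) (im (digitVal u))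
digit-octagon d0  = octagon ≤-by-decision ≤-by-decision ≤-by-decision ≤-by-decision
                            ≤-by-decision ≤-by-decision ≤-by-decision ≤-by-decision
digit-octagon d1  = octagon ≤-by-decision ≤-by-decision ≤-by-decision ≤-by-decision
                            ≤-by-decision ≤-by-decision ≤-by-decision ≤-by-decision
digit-octagon d-1 = octagon ≤-by-decision ≤-by-decision ≤-by-decision ≤-by-decision
                            ≤-by-decision ≤-by-decision ≤-by-decision ≤-by-decision
digit-octagon di  = octagon ≤-by-decision ≤-by-decision ≤-by-decision ≤-by-decision
                            ≤-by-decision ≤-by-decision ≤-by-decision ≤-by-decision
digit-octagon d-i = octagon ≤-by-decision ≤-by-decision ≤-by-decision ≤-by-decision
                            ≤-by-decision ≤-by-decision ≤-by-decision ≤-by-decision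

-- The coordinates are those of (u₁ + u₂ i) + (1+i) (x + y i).
octagon-+ᵍ-1+i*ᵍ : ∀ {u₁ u₂ x y M S} → Octagon (+ 1) (+ 1) u₁ u₂ → Octagon M S x y →
  Octagon (S + + 1) (M + M + + 1) (u₁ + (+ 1 * x - + 1 * y)) (u₂ + (+ 1 * y + + 1 * x))
octagon-+ᵍ-1+i*ᵍ {u₁} {u₂} {x} {y} {M} {S}
  (octagon q₁ q₂ q₃ q₄ q₅ q₆ q₇ q₈) (octagon h₁ h₂ h₃ h₄ h₅ h₆ h₇ h₈) = octagon
  (≤-from (q₁ ⊕ h₆) (solve vars))
  (≤-from (q₂ ⊕ h₇) (solve vars))
  (≤-from (q₃ ⊕ h₅) (solve vars))
  (≤-from (q₄ ⊕ h₈) (solve vars))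
  (≤-from (q₅ ⊕ h₁ ⊕ h₁) (solve vars))
  (≤-from (q₆ ⊕ h₄ ⊕ h₄) (solve vars))
  (≤-from (q₇ ⊕ h₃ ⊕ h₃) (solve vars))
  (≤-from (q₈ ⊕ h₂ ⊕ h₂) (solve vars))
  where vars = u₁ ∷ u₂ ∷ x ∷ y ∷ M ∷ S ∷ []

HornerB⇒InOctagon : ∀ n z → HornerB n z → InOctagon n z
HornerB⇒InOctagon zero    z (u , refl)                       = digit-octagon u
HornerB⇒InOctagon (suc n) z (u , (x + y i) , b∈B , refl) =
  octagon-mono (M-step (w (suc n))) (S-step (w n) (w (suc (suc n))) (w-suc-suc n))
    (octagon-+ᵍ-1+i*ᵍ (digit-octagon u) (HornerB⇒InOctagon n (x + y i) b∈B))
  where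
  M-step : ∀ W₁ → W₁ - + 3 + + 1 ≤ W₁ - + 2
  M-step W₁ = ≤-from (≤-refl {+ 0}) (solve (W₁ ∷ []))
  S-step : ∀ W₀ W₂ → W₂ ≡ W₀ + W₀ → W₀ - + 2 + (W₀ - + 2) + + 1 ≤ W₂ - + 3
  S-step W₀ _ refl = ≤-from (≤-refl {+ 0}) (solve (W₀ ∷ []))

d0⊎oddSum : ∀ u → u ≡ d0 ⊎ OddSum (digitVal u)
d0⊎oddSum d0  = inj₁ refl
d0⊎oddSum d1  = inj₂ (+ 0 , refl)
d0⊎oddSum d-1 = inj₂ (- + 1 , refl)
d0⊎oddSum di  = inj₂ (+ 0 , refl)
d0⊎oddSum d-i = inj₂ (- + 1 , refl)

oddSum-+ᵍ-1+i*ᵍ : ∀ z b → OddSum z → OddSum (z +ᵍ (1+i *ᵍ b))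
oddSum-+ᵍ-1+i*ᵍ (x + y i) (b₁ + b₂ i) (k , x+y≡) = k + b₁ , (begin
  (x + (+ 1 * b₁ - + 1 * b₂)) + (y + (+ 1 * b₂ + + 1 * b₁))  ≡⟨ solve (x ∷ y ∷ b₁ ∷ b₂ ∷ []) ⟩
  (x + y) + b₁ * + 2                                          ≡⟨ cong (_+ b₁ * + 2) x+y≡ ⟩
  k * + 2 + + 1 + b₁ * + 2                                    ≡⟨ solve (k ∷ b₁ ∷ []) ⟩
  (k + b₁) * + 2 + + 1                                        ∎)
  where open ≡-Reasoning

Decomposition : ℕ → ℤ[i] → Set
Decomposition n z = Σ ℕ (λ j → j ℕ.≤ n × Σ ℤ[i] (λ d → InD (n ∸ j) d × z ≡ pow1+i j *ᵍ d))

HornerB∧oddSum⇒Decomposition : ∀ n z → HornerB n z → OddSum z → Decomposition n z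
HornerB∧oddSum⇒Decomposition n z z∈B odd =
  0 , z≤n , z , OddSum∧InOctagon⇒InD n z odd (HornerB⇒InOctagon n z z∈B) , sym (pow1+i-zero-*ᵍ z)

HornerB⇒Decomposition : ∀ n z → HornerB n z → z ≢ 0ᵍ → Decomposition n z
HornerB⇒Decomposition zero z z∈B@(u , refl) z≢0 with d0⊎oddSum u
... | inj₁ refl = ⊥-elim (z≢0 refl)
... | inj₂ odd  = HornerB∧oddSum⇒Decomposition 0 z z∈B odd
HornerB⇒Decomposition (suc n) z z∈B@(u , b , b∈B , refl) z≢0 with d0⊎oddSum u
... | inj₂ odd  = HornerB∧oddSum⇒Decomposition (suc n) z z∈B (oddSum-+ᵍ-1+i*ᵍ (digitVal u) b odd)
... | inj₁ refl with HornerB⇒Decomposition n b b∈B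
                       (λ b≡0 → z≢0 (trans (+ᵍ-identityˡ (1+i *ᵍ b)) (cong (1+i *ᵍ_) b≡0)))
...   | j , j≤n , d , d∈D , b≡ = suc j , s≤s j≤n , d , d∈D , (begin
  0ᵍ +ᵍ (1+i *ᵍ b)           ≡⟨ +ᵍ-identityˡ (1+i *ᵍ b) ⟩
  1+i *ᵍ b                   ≡⟨ cong (1+i *ᵍ_) b≡ ⟩
  1+i *ᵍ (pow1+i j *ᵍ d)     ≡⟨ pow1+i-suc-*ᵍ j d ⟨
  pow1+i (suc j) *ᵍ d        ∎)
  where open ≡-Reasoning

¬oddSum-1+i*ᵍ : ∀ z → ¬ OddSum (1+i *ᵍ z)
¬oddSum-1+i*ᵍ z = even⇒¬odd (re z , 1+i*ᵍ-re+im z)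

¬oddSum-pow1+i-suc-*ᵍ : ∀ j d → ¬ OddSum (pow1+i (suc j) *ᵍ d)
¬oddSum-pow1+i-suc-*ᵍ j d odd = ¬oddSum-1+i*ᵍ (pow1+i j *ᵍ d) (subst OddSum (pow1+i-suc-*ᵍ j d) odd)

pow1+i*ᵍ-nonzero : ∀ j d → OddSum d → pow1+i j *ᵍ d ≢ 0ᵍ
pow1+i*ᵍ-nonzero zero    d odd eq with trans (sym (pow1+i-zero-*ᵍ d)) eq
... | refl = even⇒¬odd (+ 0 , refl) odd
pow1+i*ᵍ-nonzero (suc j) d odd eq =
  pow1+i*ᵍ-nonzero j d odd (1+i*ᵍ-injective _ 0ᵍ (trans (sym (pow1+i-suc-*ᵍ j d)) eq))

pow1+i-exponent-unique : ∀ j j′ d d′ → OddSum d → OddSum d′ → pow1+i j *ᵍ d ≡ pow1+i j′ *ᵍ d′ → j ≡ j′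
pow1+i-exponent-unique zero    zero     d d′ _   _    _  = refl
pow1+i-exponent-unique zero    (suc j′) d d′ odd _    eq =
  ⊥-elim (¬oddSum-pow1+i-suc-*ᵍ j′ d′ (subst OddSum (trans (sym (pow1+i-zero-*ᵍ d)) eq) odd))
pow1+i-exponent-unique (suc j) zero     d d′ _   odd′ eq =
  ⊥-elim (¬oddSum-pow1+i-suc-*ᵍ j d (subst OddSum (trans (sym (pow1+i-zero-*ᵍ d′)) (sym eq)) odd′))
pow1+i-exponent-unique (suc j) (suc j′) d d′ odd odd′ eq =
  cong suc (pow1+i-exponent-unique j j′ d d′ odd odd′
    (1+i*ᵍ-injective _ _ (trans (sym (pow1+i-suc-*ᵍ j d)) (trans eq (pow1+i-suc-*ᵍ j′ d′)))))

-- D_n ⊆ B_n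

UnitPlusOddPoint : ℤ → ℤ → ℤ → ℤ → Set
UnitPlusOddPoint h W x y = Σ Digit λ u → Σ ℤ λ a → Σ ℤ λ b →
  Octagon (h * + 2 - + 3) (W - + 4) (a * + 2 + + 1) (b * + 2 + + 1) ×
  x + y i ≡ digitVal u +ᵍ ((a * + 2 + + 1) + (b * + 2 + + 1) i)

module _ (h W : ℤ) (4≤2h : + 4 ≤ h * + 2) (2h+2≤W : h * + 2 + + 2 ≤ W) where

  split-off-i : ∀ a c → Octagon (h * + 2 - + 2) (W - + 3) (a * + 2 + + 1) (c * + 2) → + 0 ≤ c * + 2 →
               UnitPlusOddPoint h W (a * + 2 + + 1) (c * + 2)
  split-off-i a c (octagon h₁ h₂ h₃ h₄ h₅ h₆ h₇ h₈) 0≤y = di , a , c - + 1 , octagon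
    x≤ -x≤
    (≤-from h₃ (solve vars))
    (≤-from (4≤2h ⊕ 0≤y) (solve vars))
    (≤-from h₅ (solve vars))
    (≤-from (2h+2≤W ⊕ x≤ ⊕ 0≤y) (solve vars))
    (≤-from h₇ (solve vars))
    (≤-from (2h+2≤W ⊕ -x≤ ⊕ 0≤y) (solve vars))
    , cong₂ _+_i (solve vars) (solve vars)
    where
    vars = h ∷ W ∷ a ∷ c ∷ []
    x≤  = odd≤2h-2⇒odd≤2h-3 h (a , refl) h₁
    -x≤ = odd≤2h-2⇒odd≤2h-3 h (odd-neg (a , refl)) h₂

  split-off-−i : ∀ a c → Octagon (h * + 2 - + 2) (W - + 3) (a * + 2 + + 1) (c * + 2) → c * + 2 ≤ - + 1 →
                UnitPlusOddPoint h W (a * + 2 + + 1) (c * + 2)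
  split-off-−i a c (octagon h₁ h₂ h₃ h₄ h₅ h₆ h₇ h₈) y≤-1 = d-i , a , c , octagon
    x≤ -x≤
    (≤-from (4≤2h ⊕ y≤-1 ⊕ ≤-by-decision {+ 0} {+ 1}) (solve vars))
    (≤-from h₄ (solve vars))
    (≤-from (h₆ ⊕ y≤-1 ⊕ y≤-1) (solve vars))
    (≤-from h₆ (solve vars))
    (≤-from (h₈ ⊕ y≤-1 ⊕ y≤-1) (solve vars))
    (≤-from h₈ (solve vars))
    , cong₂ _+_i (solve vars) (solve vars)
    where
    vars = h ∷ W ∷ a ∷ c ∷ []
    x≤  = odd≤2h-2⇒odd≤2h-3 h (a , refl) h₁
    -x≤ = odd≤2h-2⇒odd≤2h-3 h (odd-neg (a , refl)) h₂

  split-off-1 : ∀ a c → Octagon (h * + 2 - + 2) (W - + 3) (a * + 2) (c * + 2 + + 1) → + 0 ≤ a * + 2 →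
               UnitPlusOddPoint h W (a * + 2) (c * + 2 + + 1)
  split-off-1 a c (octagon h₁ h₂ h₃ h₄ h₅ h₆ h₇ h₈) 0≤x = d1 , a - + 1 , c , octagon
    (≤-from h₁ (solve vars))
    (≤-from (4≤2h ⊕ 0≤x) (solve vars))
    y≤ -y≤
    (≤-from h₅ (solve vars))
    (≤-from h₆ (solve vars))
    (≤-from (2h+2≤W ⊕ y≤ ⊕ 0≤x) (solve vars))
    (≤-from (2h+2≤W ⊕ -y≤ ⊕ 0≤x) (solve vars))
    , cong₂ _+_i (solve vars) (solve vars)
    where
    vars = h ∷ W ∷ a ∷ c ∷ []
    y≤  = odd≤2h-2⇒odd≤2h-3 h (c , refl) h₃
    -y≤ = odd≤2h-2⇒odd≤2h-3 h (odd-neg (c , refl)) h₄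

  split-off-−1 : ∀ a c → Octagon (h * + 2 - + 2) (W - + 3) (a * + 2) (c * + 2 + + 1) → a * + 2 ≤ - + 1 →
                UnitPlusOddPoint h W (a * + 2) (c * + 2 + + 1)
  split-off-−1 a c (octagon h₁ h₂ h₃ h₄ h₅ h₆ h₇ h₈) x≤-1 = d-1 , a , c , octagon
    (≤-from (4≤2h ⊕ x≤-1 ⊕ ≤-by-decision {+ 0} {+ 1}) (solve vars))
    (≤-from h₂ (solve vars))
    y≤ -y≤
    (≤-from (h₇ ⊕ x≤-1 ⊕ x≤-1) (solve vars))
    (≤-from (h₈ ⊕ x≤-1 ⊕ x≤-1) (solve vars))
    (≤-from h₇ (solve vars))
    (≤-from h₈ (solve vars))
    , cong₂ _+_i (solve vars) (solve vars)
    where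
    vars = h ∷ W ∷ a ∷ c ∷ []
    y≤  = odd≤2h-2⇒odd≤2h-3 h (c , refl) h₃
    -y≤ = odd≤2h-2⇒odd≤2h-3 h (odd-neg (c , refl)) h₄

  split-off-unit : ∀ x y → Odd (x + y) → Octagon (h * + 2 - + 2) (W - + 3) x y → UnitPlusOddPoint h W x y
  split-off-unit x y (k , x+y≡) oct with parity x | parity y
  ... | inj₂ (a , refl) | inj₁ (c , refl) = [ split-off-i a c oct , split-off-−i a c oct ]′ (0≤⊎≤-1 (c * + 2))
  ... | inj₁ (a , refl) | inj₂ (c , refl) = [ split-off-1 a c oct , split-off-−1 a c oct ]′ (0≤⊎≤-1 (a * + 2))
  ... | inj₁ (a , refl) | inj₁ (c , refl) =
    ⊥-elim (even⇒¬odd {a * + 2 + c * + 2} (a + c , solve (a ∷ c ∷ [])) (k , x+y≡))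
  ... | inj₂ (a , refl) | inj₂ (c , refl) =
    ⊥-elim (even⇒¬odd {a * + 2 + + 1 + (c * + 2 + + 1)} (a + c + + 1 , solve (a ∷ c ∷ [])) (k , x+y≡))

octagon-halve : ∀ W₀ W₁ a b → Octagon (W₁ - + 3) (W₀ + W₀ - + 4) (a * + 2 + + 1) (b * + 2 + + 1) →
                Octagon (W₀ - + 2) (W₁ - + 3) (a + b + + 1) (b - a)
octagon-halve W₀ W₁ a b (octagon h₁ h₂ h₃ h₄ h₅ h₆ h₇ h₈) = octagon
  (≤-from-double h₅ (solve vars))
  (≤-from-double h₈ (solve vars))
  (≤-from-double h₇ (solve vars))
  (≤-from-double h₆ (solve vars))
  (≤-from h₃ (solve vars))
  (≤-from h₁ (solve vars))
  (≤-from h₂ (solve vars))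
  (≤-from h₄ (solve vars))
  where vars = W₀ ∷ W₁ ∷ a ∷ b ∷ []

oddPoint≡1+i*ᵍ : ∀ a b → (a * + 2 + + 1) + (b * + 2 + + 1) i ≡ 1+i *ᵍ ((a + b + + 1) + (b - a) i)
oddPoint≡1+i*ᵍ a b = cong₂ _+_i (solve (a ∷ b ∷ [])) (solve (a ∷ b ∷ []))

InD-suc⇒UnitPlusOddPoint : ∀ m h → w (suc m) ≡ h * + 2 → ∀ x y → InD (suc m) (x + y i) →
                            UnitPlusOddPoint h (w (suc (suc m))) x y
InD-suc⇒UnitPlusOddPoint m h w≡2h x y z∈D =
  split-off-unit h (w (suc (suc m))) 4≤2h 2h+2≤W x y (InD⇒OddSum (suc m) (x + y i) z∈D) octagon-z
  where
  4≤2h : + 4 ≤ h * + 2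
  4≤2h = subst (+ 4 ≤_) w≡2h (4≤w-suc m)
  2h+2≤W : h * + 2 + + 2 ≤ w (suc (suc m))
  2h+2≤W = subst (λ W₁ → W₁ + + 2 ≤ w (suc (suc m))) w≡2h (w-suc+2≤w-suc-suc m)
  octagon-z : Octagon (h * + 2 - + 2) (w (suc (suc m)) - + 3) x y
  octagon-z = subst (λ W₁ → Octagon (W₁ - + 2) (w (suc (suc m)) - + 3) x y) w≡2h
                    (InD⇒InOctagon (suc m) (x + y i) z∈D)

InD-suc⇒HornerB : ∀ m → (∀ e → InD m e → HornerB m e) → ∀ z → InD (suc m) z → HornerB (suc m) z
InD-suc⇒HornerB m InD⇒HornerB-m (x + y i) z∈D with w-suc-even m
... | h , w≡2h with InD-suc⇒UnitPlusOddPoint m h w≡2h x y z∈D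
...   | u , a , b , octagon-ab , z≡ =
  u , e , InD⇒HornerB-m e e∈D , trans (cong (digitVal u +ᵍ_) (sym (oddPoint≡1+i*ᵍ a b))) (sym z≡)
  where
  e = (a + b + + 1) + (b - a) i
  e-oddSum : Odd ((a + b + + 1) + (b - a))
  e-oddSum = b , solve (a ∷ b ∷ [])
  e∈D : InD m e
  e∈D = OddSum∧InOctagon⇒InD m e e-oddSum
          (octagon-halve (w m) (w (suc m)) a b
            (subst₂ (λ W₁ W₂ → Octagon (W₁ - + 3) (W₂ - + 4) (a * + 2 + + 1) (b * + 2 + + 1))
                    (sym w≡2h) (w-suc-suc m) octagon-ab))

InD-zero⇒HornerB : ∀ z → InD 0 z → HornerB 0 z
InD-zero⇒HornerB ((+ zero) + (+ zero) i)          (2∤0 , _)               = ⊥-elim (2∤0 (even⇒2∣ (+ 0 , refl)))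
InD-zero⇒HornerB ((+ zero) + (+ suc zero) i)      _                       = di , refl
InD-zero⇒HornerB ((+ zero) + (+ suc (suc n)) i)   (_ , _ , +≤+ (s≤s ()) , _)
InD-zero⇒HornerB ((+ zero) + -[1+ zero ] i)       _                       = d-i , refl
InD-zero⇒HornerB ((+ zero) + -[1+ suc n ] i)      (_ , _ , +≤+ (s≤s ()) , _)
InD-zero⇒HornerB ((+ suc zero) + (+ zero) i)      _                       = d1 , refl
InD-zero⇒HornerB ((+ suc zero) + (+ suc n) i)     (_ , _ , _ , +≤+ (s≤s ()))
InD-zero⇒HornerB ((+ suc zero) + -[1+ n ] i)      (_ , _ , _ , +≤+ (s≤s ()))
InD-zero⇒HornerB ((+ suc (suc n)) + y i)          (_ , +≤+ (s≤s ()) , _ , _)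
InD-zero⇒HornerB (-[1+ zero ] + (+ zero) i)       _                       = d-1 , refl
InD-zero⇒HornerB (-[1+ zero ] + (+ suc n) i)      (_ , _ , _ , +≤+ (s≤s ()))
InD-zero⇒HornerB (-[1+ zero ] + -[1+ n ] i)       (_ , _ , _ , +≤+ (s≤s ()))
InD-zero⇒HornerB (-[1+ suc n ] + y i)             (_ , +≤+ (s≤s ()) , _ , _)

InD⇒HornerB : ∀ m z → InD m z → HornerB m z
InD⇒HornerB zero    = InD-zero⇒HornerB
InD⇒HornerB (suc m) = InD-suc⇒HornerB m (InD⇒HornerB m)

pow1+i*ᵍ-HornerB : ∀ n j d → j ℕ.≤ n → HornerB (n ∸ j) d → HornerB n (pow1+i j *ᵍ d)
pow1+i*ᵍ-HornerB n       zero    d _         d∈B = subst (HornerB n) (sym (pow1+i-zero-*ᵍ d)) d∈B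
pow1+i*ᵍ-HornerB (suc n) (suc j) d (s≤s j≤n) d∈B =
  d0 , pow1+i j *ᵍ d , pow1+i*ᵍ-HornerB n j d j≤n d∈B ,
  trans (+ᵍ-identityˡ (1+i *ᵍ (pow1+i j *ᵍ d))) (sym (pow1+i-suc-*ᵍ j d))

theorem2p7 : (n : ℕ) →
    ((z : ℤ[i]) →
      (InB n z × z ≢ 0ᵍ) ⇔
      (Σ ℕ (λ j → j ℕ.≤ n × Σ ℤ[i] (λ d → InD (n ∸ j) d × z ≡ pow1+i j *ᵍ d)))) ×
    ((j j′ : ℕ) (d d′ : ℤ[i]) → j ℕ.≤ n → j′ ℕ.≤ n →
      InD (n ∸ j) d → InD (n ∸ j′) d′ →
      pow1+i j *ᵍ d ≡ pow1+i j′ *ᵍ d′ → j ≡ j′)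
theorem2p7 n = (λ z → mk⇔ (decompose z) (recompose z)) , exponent-unique
  where
  decompose : ∀ z → InB n z × z ≢ 0ᵍ → Decomposition n z
  decompose z (z∈B , z≢0) = HornerB⇒Decomposition n z (InB⇒HornerB n z z∈B) z≢0
  recompose : ∀ z → Decomposition n z → InB n z × z ≢ 0ᵍ
  recompose z (j , j≤n , d , d∈D , refl) =
    HornerB⇒InB n z (pow1+i*ᵍ-HornerB n j d j≤n (InD⇒HornerB (n ∸ j) d d∈D)) ,
    pow1+i*ᵍ-nonzero j d (InD⇒OddSum (n ∸ j) d d∈D)
  exponent-unique : ∀ j j′ d d′ → j ℕ.≤ n → j′ ℕ.≤ n → InD (n ∸ j) d → InD (n ∸ j′) d′ →
                    pow1+i j *ᵍ d ≡ pow1+i j′ *ᵍ d′ → j ≡ j′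
  exponent-unique j j′ d d′ _ _ d∈D d′∈D =
    pow1+i-exponent-unique j j′ d d′ (InD⇒OddSum (n ∸ j) d d∈D) (InD⇒OddSum (n ∸ j′) d′ d′∈D)
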